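{- Let $(S,K,I)$ be a split graph and $G$ a graph vertex-disjoint from $S$. Then $S\circ G$ is active if and only if both $S$ and $G$ are active.
   Context: A split graph $(S,K,I)$ is a graph $S$ with a partition of its vertex set into a clique $K$ and an independent set $I$. The composition $S\circ G$ is the graph obtained from the disjoint union of $S$ and $G$ by adding all edges between $K$ and $V(G)$. A vertex $v$ of a graph $H$ is active if it lies in a 4-vertex set $W$ such that the induced subgraph $\langle W\rangle_H$ is isomorphic to $P_4$, $C_4$ or $2K_2$. A graph is active if all of its vertices are active (the graph with no vertices is active). -}

module Defs where

open import Data.Nat using (ℕ; _+_)
open import Data.Fin using (Fin; splitAt; zero; suc)
open import Data.Bool using (Bool; true; false; T; not; _∧_)
open import Data.Sum using (_⊎_; inj₁; inj₂)
open import Data.Product using (∃; _×_)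
open import Relation.Binary.PropositionalEquality using (_≡_; refl)
open import Function.Definitions using (Injective)

record Graph : Set where
  field
    n     : ℕ
    adj   : Fin n → Fin n → Bool
    sym   : ∀ u v → adj u v ≡ adj v u
    irrefl : ∀ v → adj v v ≡ false
open Graph public

-- A split graph (S, K, I): a graph S together with a partition of its
-- vertices into K (inK v ≡ true) and I (inK v ≡ false), K a clique and
-- I an independent set.
record SplitGraph : Set where
  field
    graph  : Graph
    inK    : Fin (n graph) → Bool
    clique : ∀ u v → T (inK u) → T (inK v) → u ≡ v ⊎ T (adj graph u v)
    indep  : ∀ u v → T (not (inK u)) → T (not (inK v)) → adj graph u v ≡ false
open SplitGraph public

-- The composition S ∘ G: disjoint union of S and G (vertex set
-- Fin (n S + n G), S first), plus all edges between K and V(G).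
compAdj : (S : SplitGraph) (G : Graph) →
          Fin (n (graph S) + n G) → Fin (n (graph S) + n G) → Bool
compAdj S G u v with splitAt (n (graph S)) u | splitAt (n (graph S)) v
... | inj₁ a | inj₁ b = adj (graph S) a b
... | inj₁ a | inj₂ _ = inK S a
... | inj₂ _ | inj₁ b = inK S b
... | inj₂ a | inj₂ b = adj G a b

compSym : (S : SplitGraph) (G : Graph) → ∀ u v → compAdj S G u v ≡ compAdj S G v u
compSym S G u v with splitAt (n (graph S)) u | splitAt (n (graph S)) v
... | inj₁ a | inj₁ b = sym (graph S) a b
... | inj₁ a | inj₂ _ = refl
... | inj₂ _ | inj₁ b = refl
... | inj₂ a | inj₂ b = sym G a b

compIrrefl : (S : SplitGraph) (G : Graph) → ∀ v → compAdj S G v v ≡ false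
compIrrefl S G v with splitAt (n (graph S)) v
... | inj₁ a = irrefl (graph S) a
... | inj₂ a = irrefl G a

_∘G_ : SplitGraph → Graph → Graph
S ∘G G = record
  { n = n (graph S) + n G
  ; adj = compAdj S G
  ; sym = compSym S G
  ; irrefl = compIrrefl S G
  }

P4 : Fin 4 → Fin 4 → Bool
P4 zero (suc zero) = true
P4 (suc zero) zero = true
P4 (suc zero) (suc (suc zero)) = true
P4 (suc (suc zero)) (suc zero) = true
P4 (suc (suc zero)) (suc (suc (suc zero))) = true
P4 (suc (suc (suc zero))) (suc (suc zero)) = true
P4 _ _ = false

C4 : Fin 4 → Fin 4 → Bool
C4 zero (suc (suc (suc zero))) = true
C4 (suc (suc (suc zero))) zero = true
C4 u v = P4 u v

TwoK2 : Fin 4 → Fin 4 → Bool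
TwoK2 zero (suc zero) = true
TwoK2 (suc zero) zero = true
TwoK2 (suc (suc zero)) (suc (suc (suc zero))) = true
TwoK2 (suc (suc (suc zero))) (suc (suc zero)) = true
TwoK2 _ _ = false

InducedCopyAt : (G : Graph) (H : Fin 4 → Fin 4 → Bool) → Fin (n G) → Set
InducedCopyAt G H v =
  ∃ λ (f : Fin 4 → Fin (n G)) →
    Injective _≡_ _≡_ f × (∀ i j → adj G (f i) (f j) ≡ H i j) × (∃ λ i → f i ≡ v)

ActiveVertex : (G : Graph) → Fin (n G) → Set
ActiveVertex G v = InducedCopyAt G P4 v ⊎ InducedCopyAt G C4 v ⊎ InducedCopyAt G TwoK2 v

Active : Graph → Set
Active G = ∀ v → ActiveVertex G v

-- Each of P4, C4 and 2K2 is an alternating 4-cycle w ~ x ≁ y ~ z ≁ w on its four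
-- vertices.  In S ∘ G an independent vertex is adjacent only to clique vertices, and a
-- clique vertex is non-adjacent to another vertex only if that vertex is independent.
-- So walking an alternating cycle from a vertex of S (along the edge from an
-- independent vertex, along the non-edge from a clique vertex) never leaves S: every
-- induced P4, C4 or 2K2 of S ∘ G lies inside S or inside G.  Since S and G are induced
-- subgraphs of S ∘ G, activity of a vertex transfers in both directions.

module Submission where

open import Defs
open import Data.Bool using (Bool; true; false; if_then_else_)
open import Data.Bool.Properties using (T-≡; T-not-≡)
open import Data.Fin using (Fin; splitAt; _↑ˡ_; _↑ʳ_)
open import Data.Fin.Patterns using (0F; 1F; 2F; 3F)
open import Data.Fin.Properties
  using (splitAt-↑ˡ; splitAt-↑ʳ; splitAt⁻¹-↑ˡ; splitAt⁻¹-↑ʳ; ↑ˡ-injective; ↑ʳ-injective)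
open import Data.Nat using (_+_)
open import Data.Product using (_×_; _,_; proj₁; proj₂; ∃)
open import Data.Sum using (inj₁; inj₂)
open import Function.Bundles using (_⇔_; mk⇔; module Equivalence)
open import Function.Definitions using (Injective)
open import Relation.Binary.PropositionalEquality
  using (_≡_; _≢_; refl; trans; cong; cong₂; subst; ≢-sym) renaming (sym to ≡-sym)
open import Relation.Nullary using (¬_; contradiction)

private
  variable
    A : Set
    E H : A → A → Bool
    w x y z : A

record Alternating {A : Set} (E : A → A → Bool) (w x y z : A) : Set where
  constructor alternating
  field
    w~x : E w x ≡ true
    x≁y : E x y ≡ false
    y~z : E y z ≡ true
    z≁w : E z w ≡ false
    x≢y : x ≢ y
    z≢w : z ≢ w

rotate : Alternating E w x y z → Alternating E y z w x
rotate (alternating w~x x≁y y~z z≁w x≢y z≢w) = alternating y~z z≁w w~x x≁y z≢w x≢y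

reflect : (∀ u v → E u v ≡ E v u) → Alternating E w x y z → Alternating E x w z y
reflect {w = w} {x} {y} {z} E-sym (alternating w~x x≁y y~z z≁w x≢y z≢w) =
  alternating (trans (E-sym x w) w~x) (trans (E-sym w z) z≁w)
              (trans (E-sym z y) y~z) (trans (E-sym y x) x≁y) (≢-sym z≢w) (≢-sym x≢y)

private
  variable
    G G′ : Graph

induced-alternating : (f : Fin 4 → Fin (n G)) → Injective _≡_ _≡_ f →
                      (∀ i j → adj G (f i) (f j) ≡ H i j) →
                      Alternating H w x y z → Alternating (adj G) (f w) (f x) (f y) (f z)
induced-alternating {w = w} {x} {y} {z} f f-inj f-adj (alternating w~x x≁y y~z z≁w x≢y z≢w) =
  alternating (trans (f-adj w x) w~x) (trans (f-adj x y) x≁y)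
              (trans (f-adj y z) y~z) (trans (f-adj z w) z≁w)
              (λ fx≡fy → x≢y (f-inj fx≡fy)) (λ fz≡fw → z≢w (f-inj fz≡fw))

record InducedEmbedding (G G′ : Graph) : Set where
  field
    embed     : Fin (n G) → Fin (n G′)
    injective : Injective _≡_ _≡_ embed
    adj-embed : ∀ u v → adj G′ (embed u) (embed v) ≡ adj G u v
open InducedEmbedding

copy-push : ∀ {v} (e : InducedEmbedding G G′) → InducedCopyAt G H v → InducedCopyAt G′ H (embed e v)
copy-push e (f , f-inj , f-adj , i , fi≡v) =
  (λ j → embed e (f j)) ,
  (λ eq → f-inj (injective e eq)) ,
  (λ i j → trans (adj-embed e (f i) (f j)) (f-adj i j)) ,
  i , cong (embed e) fi≡v

copy-pull : ∀ {v} (e : InducedEmbedding G G′) (c : InducedCopyAt G′ H (embed e v)) →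
            (∀ i → ∃ λ u → embed e u ≡ proj₁ c i) → InducedCopyAt G H v
copy-pull {G = G} {G′} {H} {v} e (f , f-inj , f-adj , i , fi≡ev) preimage = g , g-inj , g-adj , i , gi≡v
  where
    g : Fin 4 → Fin (n G)
    g j = proj₁ (preimage j)

    embed-g : ∀ j → embed e (g j) ≡ f j
    embed-g j = proj₂ (preimage j)

    g-inj : Injective _≡_ _≡_ g
    g-inj {x} {y} gx≡gy = f-inj (trans (≡-sym (embed-g x)) (trans (cong (embed e) gx≡gy) (embed-g y)))

    g-adj : ∀ x y → adj G (g x) (g y) ≡ H x y
    g-adj x y = trans (≡-sym (adj-embed e (g x) (g y)))
                      (trans (cong₂ (adj G′) (embed-g x) (embed-g y)) (f-adj x y))

    gi≡v : g i ≡ v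
    gi≡v = injective e (trans (embed-g i) fi≡ev)

P4-alternating : Alternating P4 0F 1F 3F 2F
P4-alternating = alternating refl refl refl refl (λ ()) (λ ())

C4-alternating : Alternating C4 0F 1F 3F 2F
C4-alternating = alternating refl refl refl refl (λ ()) (λ ())

TwoK2-alternating : Alternating TwoK2 0F 1F 3F 2F
TwoK2-alternating = alternating refl refl refl refl (λ ()) (λ ())

ActiveVertex-map : ∀ {v v′} →
  (∀ {H} → Alternating H 0F 1F 3F 2F → InducedCopyAt G H v → InducedCopyAt G′ H v′) →
  ActiveVertex G v → ActiveVertex G′ v′
ActiveVertex-map transfer (inj₁ p4)        = inj₁ (transfer P4-alternating p4)
ActiveVertex-map transfer (inj₂ (inj₁ c4)) = inj₂ (inj₁ (transfer C4-alternating c4))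
ActiveVertex-map transfer (inj₂ (inj₂ k2)) = inj₂ (inj₂ (transfer TwoK2-alternating k2))

data Part : Set where
  cliquePart independentPart outerPart : Part

module Composition (S : SplitGraph) (G : Graph) where

  private
    C = S ∘G G
    m = n (graph S)
    k = n G

  adj-↑ˡ : ∀ a b → adj C (a ↑ˡ k) (b ↑ˡ k) ≡ adj (graph S) a b
  adj-↑ˡ a b rewrite splitAt-↑ˡ m a k | splitAt-↑ˡ m b k = refl

  adj-↑ʳ : ∀ a b → adj C (m ↑ʳ a) (m ↑ʳ b) ≡ adj G a b
  adj-↑ʳ a b rewrite splitAt-↑ʳ m k a | splitAt-↑ʳ m k b = refl

  inl : InducedEmbedding (graph S) C
  inl = record { embed = _↑ˡ k ; injective = ↑ˡ-injective k _ _ ; adj-embed = adj-↑ˡ }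

  inr : InducedEmbedding G C
  inr = record { embed = m ↑ʳ_ ; injective = ↑ʳ-injective m _ _ ; adj-embed = adj-↑ʳ }

  part : Fin (m + k) → Part
  part u with splitAt m u
  ... | inj₁ a = if inK S a then cliquePart else independentPart
  ... | inj₂ _ = outerPart

  independent-neighbour : ∀ u v → part u ≡ independentPart → adj C u v ≡ true → part v ≡ cliquePart
  independent-neighbour u v u∈I u~v with splitAt m u | splitAt m v
  ... | inj₂ _ | _ = contradiction u∈I λ ()
  ... | inj₁ a | inj₂ _ with inK S a
  ...   | true  = contradiction u∈I λ ()
  ...   | false = contradiction u~v λ ()
  independent-neighbour u v u∈I u~v | inj₁ a | inj₁ b with inK S a in a∉K | inK S b in b∈K
  ...   | true  | _     = contradiction u∈I λ ()
  ...   | false | true  = refl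
  ...   | false | false =
    contradiction (trans (≡-sym u~v) (indep S a b (Equivalence.from T-not-≡ a∉K) (Equivalence.from T-not-≡ b∈K))) λ ()

  clique-non-neighbour : ∀ u v → u ≢ v → part u ≡ cliquePart → adj C u v ≡ false → part v ≡ independentPart
  clique-non-neighbour u v u≢v u∈K u≁v with splitAt m u in eu | splitAt m v in ev
  ... | inj₂ _ | _ = contradiction u∈K λ ()
  ... | inj₁ a | inj₂ _ with inK S a
  ...   | true  = contradiction u≁v λ ()
  ...   | false = contradiction u∈K λ ()
  clique-non-neighbour u v u≢v u∈K u≁v | inj₁ a | inj₁ b with inK S a in a∈K | inK S b in b∈K
  ...   | false | _     = contradiction u∈K λ ()
  ...   | true  | false = refl
  ...   | true  | true with clique S a b (Equivalence.from T-≡ a∈K) (Equivalence.from T-≡ b∈K)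
  ...     | inj₁ a≡b = contradiction (trans (≡-sym (splitAt⁻¹-↑ˡ eu)) (trans (cong (_↑ˡ k) a≡b) (splitAt⁻¹-↑ˡ ev))) u≢v
  ...     | inj₂ a~b = contradiction (trans (≡-sym u≁v) (Equivalence.to T-≡ a~b)) λ ()

  data InS (u : Fin (m + k)) : Set where
    inClique      : part u ≡ cliquePart → InS u
    inIndependent : part u ≡ independentPart → InS u

  alternating-inS : Alternating (adj C) w x y z → InS w → InS x × InS y × InS z
  alternating-inS {w = w} {x} {y} {z} (alternating w~x x≁y y~z z≁w x≢y z≢w) (inIndependent w∈I) =
    inClique x∈K , inIndependent y∈I , inClique z∈K
    where
      x∈K : part x ≡ cliquePart
      x∈K = independent-neighbour w x w∈I w~x
      y∈I : part y ≡ independentPart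
      y∈I = clique-non-neighbour x y x≢y x∈K x≁y
      z∈K : part z ≡ cliquePart
      z∈K = independent-neighbour y z y∈I y~z
  alternating-inS {w = w} {x} {y} {z} (alternating w~x x≁y y~z z≁w x≢y z≢w) (inClique w∈K) =
    inIndependent x∈I , inClique y∈K , inIndependent z∈I
    where
      z∈I : part z ≡ independentPart
      z∈I = clique-non-neighbour w z (≢-sym z≢w) w∈K (trans (sym C w z) z≁w)
      y∈K : part y ≡ cliquePart
      y∈K = independent-neighbour z y z∈I (trans (sym C z y) y~z)
      x∈I : part x ≡ independentPart
      x∈I = clique-non-neighbour y x (≢-sym x≢y) y∈K (trans (sym C y x) x≁y)

  inS-spreads : (f : Fin 4 → Fin (m + k)) → Alternating (adj C) (f 0F) (f 1F) (f 3F) (f 2F) →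
                ∀ i j → InS (f i) → InS (f j)
  inS-spreads f square i j fi∈S = from₀ j (to₀ i fi∈S)
    where
      to₀ : ∀ i → InS (f i) → InS (f 0F)
      to₀ 0F f₀∈S = f₀∈S
      to₀ 1F f₁∈S = proj₁ (alternating-inS (reflect (sym C) square) f₁∈S)
      to₀ 2F f₂∈S = proj₂ (proj₂ (alternating-inS (reflect (sym C) (rotate square)) f₂∈S))
      to₀ 3F f₃∈S = proj₁ (proj₂ (alternating-inS (rotate square) f₃∈S))

      from₀ : ∀ j → InS (f 0F) → InS (f j)
      from₀ 0F f₀∈S = f₀∈S
      from₀ 1F f₀∈S = proj₁ (alternating-inS square f₀∈S)
      from₀ 2F f₀∈S = proj₂ (proj₂ (alternating-inS square f₀∈S))
      from₀ 3F f₀∈S = proj₁ (proj₂ (alternating-inS square f₀∈S))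

  part-↑ˡ≢outerPart : ∀ a → part (a ↑ˡ k) ≢ outerPart
  part-↑ˡ≢outerPart a rewrite splitAt-↑ˡ m a k with inK S a
  ... | true  = λ ()
  ... | false = λ ()

  part-↑ʳ : ∀ b → part (m ↑ʳ b) ≡ outerPart
  part-↑ʳ b rewrite splitAt-↑ʳ m k b = refl

  inS-↑ˡ : ∀ a → InS (a ↑ˡ k)
  inS-↑ˡ a with part (a ↑ˡ k) in p
  ... | cliquePart      = inClique p
  ... | independentPart = inIndependent p
  ... | outerPart       = contradiction p (part-↑ˡ≢outerPart a)

  ¬inS-↑ʳ : ∀ b → ¬ InS (m ↑ʳ b)
  ¬inS-↑ʳ b (inClique p)      = contradiction (trans (≡-sym (part-↑ʳ b)) p) λ ()
  ¬inS-↑ʳ b (inIndependent p) = contradiction (trans (≡-sym (part-↑ʳ b)) p) λ ()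

  inS⇒↑ˡ : ∀ u → InS u → ∃ λ a → a ↑ˡ k ≡ u
  inS⇒↑ˡ u u∈S with splitAt m u in eu
  ... | inj₁ a = a , splitAt⁻¹-↑ˡ eu
  ... | inj₂ b = contradiction (subst InS (≡-sym (splitAt⁻¹-↑ʳ eu)) u∈S) (¬inS-↑ʳ b)

  ¬inS⇒↑ʳ : ∀ u → ¬ InS u → ∃ λ b → m ↑ʳ b ≡ u
  ¬inS⇒↑ʳ u u∉S with splitAt m u in eu
  ... | inj₁ a = contradiction (subst InS (splitAt⁻¹-↑ˡ eu) (inS-↑ˡ a)) u∉S
  ... | inj₂ b = b , splitAt⁻¹-↑ʳ eu

  restrict-↑ˡ : ∀ {H a} → Alternating H 0F 1F 3F 2F →
                InducedCopyAt C H (a ↑ˡ k) → InducedCopyAt (graph S) H a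
  restrict-↑ˡ {a = a} square c@(f , f-inj , f-adj , i , fi≡a) =
    copy-pull inl c λ j → inS⇒↑ˡ (f j) (inS-spreads f square′ i j fi∈S)
    where
      square′ : Alternating (adj C) (f 0F) (f 1F) (f 3F) (f 2F)
      square′ = induced-alternating {G = C} f f-inj f-adj square
      fi∈S : InS (f i)
      fi∈S = subst InS (≡-sym fi≡a) (inS-↑ˡ a)

  restrict-↑ʳ : ∀ {H b} → Alternating H 0F 1F 3F 2F →
                InducedCopyAt C H (m ↑ʳ b) → InducedCopyAt G H b
  restrict-↑ʳ {b = b} square c@(f , f-inj , f-adj , i , fi≡b) =
    copy-pull inr c λ j → ¬inS⇒↑ʳ (f j) λ fj∈S →
      ¬inS-↑ʳ b (subst InS fi≡b (inS-spreads f square′ j i fj∈S))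
    where
      square′ : Alternating (adj C) (f 0F) (f 1F) (f 3F) (f 2F)
      square′ = induced-alternating {G = C} f f-inj f-adj square

  active⇒active-S : Active C → Active (graph S)
  active⇒active-S active a = ActiveVertex-map {G = C} {graph S} restrict-↑ˡ (active (a ↑ˡ k))

  active⇒active-G : Active C → Active G
  active⇒active-G active b = ActiveVertex-map {G = C} {G} restrict-↑ʳ (active (m ↑ʳ b))

  active-S-G⇒active : Active (graph S) → Active G → Active C
  active-S-G⇒active active-S active-G u with splitAt m u in eu
  ... | inj₁ a = subst (ActiveVertex C) (splitAt⁻¹-↑ˡ eu) (ActiveVertex-map {G = graph S} {C} (λ _ → copy-push inl) (active-S a))
  ... | inj₂ b = subst (ActiveVertex C) (splitAt⁻¹-↑ʳ eu) (ActiveVertex-map {G = G} {C} (λ _ → copy-push inr) (active-G b))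

mainTheorem8 : (S : SplitGraph) (G : Graph) →
    Active (S ∘G G) ⇔ (Active (graph S) × Active G)
mainTheorem8 S G =
  mk⇔ (λ active → active⇒active-S active , active⇒active-G active)
      (λ (active-S , active-G) → active-S-G⇒active active-S active-G)
  where open Composition S G
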